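{- Let $(A,X,I)$ be a formal context and $\{R_i\}_{i\in\mathsf{Ag}}$ a family of $I$-compatible relations $R_i\subseteq A\times X$ indexed by a finite set $\mathsf{Ag}$. Then for every nonempty finite sequence $s$ over $\mathsf{Ag}$, the relation $R_s$ is $I$-compatible.
   Context: For $S\subseteq A\times X$, $B\subseteq A$, $Y\subseteq X$: $S^\uparrow[B]=\{x\mid\forall a\in B,\ aSx\}$, $S^\downarrow[Y]=\{a\mid\forall x\in Y,\ aSx\}$, $S^\uparrow[a]=S^\uparrow[\{a\}]$, $S^\downarrow[x]=S^\downarrow[\{x\}]$, $B^\uparrow=I^\uparrow[B]$, $Y^\downarrow=I^\downarrow[Y]$, $x^{\downarrow\uparrow}=\{x\}^{\downarrow\uparrow}$. Galois-stable: $B=B^{\uparrow\downarrow}$, $Y=Y^{\downarrow\uparrow}$. $R$ is $I$-compatible if $R^\downarrow[x]$ and $R^\uparrow[a]$ are Galois-stable for all $x,a$. $R_s$ is defined recursively: $R_s=R_i$ if $s=i$; if $s=it$ then $R_s$ is given by $R_s^\downarrow[x]=R_i^\downarrow[I^\uparrow[R_t^\downarrow[x^{\downarrow\uparrow}]]]$ for all $x\in X$. -}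

module Defs where

open import Level using (Level; suc)
open import Data.Nat using (ℕ)
open import Data.Fin using (Fin)
open import Data.Product using (_×_)
open import Data.List.NonEmpty using (List⁺; _∷_)
open import Data.List using (List; []; _∷_)
open import Relation.Binary.PropositionalEquality using (_≡_)

Subset : ∀ {ℓ} → Set ℓ → Set (suc ℓ)
Subset {ℓ} A = A → Set ℓ

Rel : ∀ {ℓ} → Set ℓ → Set ℓ → Set (suc ℓ)
Rel {ℓ} A X = A → X → Set ℓ

_≐_ : ∀ {ℓ} {A : Set ℓ} → Subset A → Subset A → Set ℓ
B ≐ C = (∀ a → B a → C a) × (∀ a → C a → B a)

⟦_⟧ : ∀ {ℓ} {A : Set ℓ} → A → Subset A
⟦ x ⟧ y = x ≡ y

module _ {ℓ} {A X : Set ℓ} where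
  _↑[_] : Rel A X → Subset A → Subset X
  (S ↑[ B ]) x = ∀ a → B a → S a x

  _↓[_] : Rel A X → Subset X → Subset A
  (S ↓[ Y ]) a = ∀ x → Y x → S a x

  module Galois (I : Rel A X) where
    _↑ : Subset A → Subset X
    B ↑ = I ↑[ B ]

    _↓ : Subset X → Subset A
    Y ↓ = I ↓[ Y ]

    StableA : Subset A → Set ℓ
    StableA B = B ≐ ((B ↑) ↓)

    StableX : Subset X → Set ℓ
    StableX Y = Y ≐ ((Y ↓) ↑)

    Compatible : Rel A X → Set ℓ
    Compatible R = (∀ x → StableA (R ↓[ ⟦ x ⟧ ])) × (∀ a → StableX (R ↑[ ⟦ a ⟧ ]))

    -- R_s for a nonempty sequence s over the agents Ag:
    --   R_i = R i ;  R_{i t} ↓[x] = R_i ↓[ I↑[ R_t ↓[ x↓↑ ] ] ]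
    -- a R_s x  iff  a ∈ R_s↓[x].
    Rseq : ∀ {a} {Ag : Set a} → (Ag → Rel A X) → Ag → List Ag → Rel A X
    Rseq R i []      a x = R i a x
    Rseq R i (j ∷ t) a x =
      (R i ↓[ I ↑[ Rseq R j t ↓[ (⟦ x ⟧ ↓) ↑ ] ] ]) a

    Rₛ : ∀ {a} {Ag : Set a} → (Ag → Rel A X) → List⁺ Ag → Rel A X
    Rₛ R (i ∷ t) = Rseq R i t

module Submission where

-- The relations R_s are built from the R_i by iterating one binary
-- operation on relations,  (S ⊙ T)↓[x] = S↓[ I↑[ T↓[x↓↑] ] ],  since
-- R_{i t} = R_i ⊙ R_t.  So it suffices to show that ⊙ preserves
-- I-compatibility; the theorem then follows by induction on the sequence.
--
-- To prove that, compatibility of S is split into two closure properties: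
--   * every S↓[x] is Galois-closed, which upgrades to: every S↓[Y] is closed
--     (an intersection of closed sets);
--   * every S↑[a] is Galois-closed, which is equivalent to: S↓[Y] ⊆ S↓[Y↓↑]
--     for every Y (the relation cannot tell Y from its Galois closure).
-- For S ⊙ T the first property is immediate, because (S ⊙ T)↓[x] is of the
-- form S↓[Z].  The second one uses both properties of T and the closedness of
-- S↑[a], through the adjunction  a ∈ S↓[Y]  ⇔  Y ⊆ S↑[a].

open import Defs
import Level
open Level using (Level)
open import Data.Nat using (ℕ)
open import Data.Fin using (Fin)
open import Data.List.NonEmpty using (List⁺; _∷_)
open import Data.List using (List; []; _∷_)
open import Data.Product using (_,_; proj₁; proj₂)
open import Relation.Binary.PropositionalEquality using (refl; subst)

module FormalContext {ℓ : Level} {A X : Set ℓ} (I : Rel A X) where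
  open Galois I

  infix 4 _⊆_
  _⊆_ : {U : Set ℓ} → Subset U → Subset U → Set ℓ
  B ⊆ C = ∀ u → B u → C u

  ↓[]-antitone : (S : Rel A X) {Y Z : Subset X} → Y ⊆ Z → S ↓[ Z ] ⊆ S ↓[ Y ]
  ↓[]-antitone S Y⊆Z a aZ y Yy = aZ y (Y⊆Z y Yy)

  ↑-antitone : {B C : Subset A} → B ⊆ C → C ↑ ⊆ B ↑
  ↑-antitone B⊆C x xC b Bb = xC b (B⊆C b Bb)

  ↑↓-monotone : {B C : Subset A} → B ⊆ C → (B ↑) ↓ ⊆ (C ↑) ↓
  ↑↓-monotone B⊆C = ↓[]-antitone I (↑-antitone B⊆C)

  ↓↑-monotone : {Y Z : Subset X} → Y ⊆ Z → (Y ↓) ↑ ⊆ (Z ↓) ↑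
  ↓↑-monotone Y⊆Z = ↑-antitone (↓[]-antitone I Y⊆Z)

  ↑↓-extensive : (B : Subset A) → B ⊆ (B ↑) ↓
  ↑↓-extensive B b Bb x xB = xB b Bb

  ↓↑-extensive : (Y : Subset X) → Y ⊆ (Y ↓) ↑
  ↓↑-extensive Y y Yy b bY = bY y Yy

  ↓↑-member : {Y : Subset X} {x : X} → ((Y ↓) ↑) x → ((⟦ x ⟧ ↓) ↑) ⊆ ((Y ↓) ↑)
  ↓↑-member {x = x} xY z xz b bY = xz b (λ { _ refl → xY b bY })

  ↓[]⇒⊆↑[] : (S : Rel A X) {Y : Subset X} {a : A} →
             (S ↓[ Y ]) a → Y ⊆ S ↑[ ⟦ a ⟧ ]
  ↓[]⇒⊆↑[] S aY y Yy _ refl = aY y Yy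

  ⊆↑[]⇒↓[] : (S : Rel A X) {Y : Subset X} {a : A} →
             Y ⊆ S ↑[ ⟦ a ⟧ ] → (S ↓[ Y ]) a
  ⊆↑[]⇒↓[] S Y⊆Sa y Yy = Y⊆Sa y Yy _ refl

  -- Galois-closed sets; stability is closedness, the other inclusion being
  -- extensivity.
  ClosedA : Subset A → Set ℓ
  ClosedA B = (B ↑) ↓ ⊆ B

  ClosedX : Subset X → Set ℓ
  ClosedX Y = (Y ↓) ↑ ⊆ Y

  DownClosed : Rel A X → Set (Level.suc ℓ)
  DownClosed S = ∀ Y → ClosedA (S ↓[ Y ])

  RespectsClosure : Rel A X → Set (Level.suc ℓ)
  RespectsClosure S = ∀ Y → S ↓[ Y ] ⊆ S ↓[ (Y ↓) ↑ ]

  -- If every S↓[x] is closed then so is every S↓[Y] = ⋂_{y ∈ Y} S↓[y].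
  pointwise⇒downClosed : (S : Rel A X) →
                         (∀ x → ClosedA (S ↓[ ⟦ x ⟧ ])) → DownClosed S
  pointwise⇒downClosed S closed Y a aY y Yy =
    closed y a (↑↓-monotone (λ b bY → λ { _ refl → bY y Yy }) a aY) y refl

  upClosed⇒respects : (S : Rel A X) →
                      (∀ a → ClosedX (S ↑[ ⟦ a ⟧ ])) → RespectsClosure S
  upClosed⇒respects S closed Y a aY =
    ⊆↑[]⇒↓[] S (λ x xY → closed a x (↓↑-monotone (↓[]⇒⊆↑[] S aY) x xY))

  respects⇒upClosed : (S : Rel A X) →
                      RespectsClosure S → ∀ a → ClosedX (S ↑[ ⟦ a ⟧ ])
  respects⇒upClosed S respects a =
    ↓[]⇒⊆↑[] S (respects (S ↑[ ⟦ a ⟧ ]) a (⊆↑[]⇒↓[] S (λ x ax → ax)))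

  compatible⇒downClosed : (S : Rel A X) → Compatible S → DownClosed S
  compatible⇒downClosed S c = pointwise⇒downClosed S (λ x → proj₂ (proj₁ c x))

  compatible⇒respects : (S : Rel A X) → Compatible S → RespectsClosure S
  compatible⇒respects S c = upClosed⇒respects S (λ a → proj₂ (proj₂ c a))

  compatible-intro : (S : Rel A X) → (∀ x → ClosedA (S ↓[ ⟦ x ⟧ ])) →
                     RespectsClosure S → Compatible S
  compatible-intro S downClosed respects =
      (λ x → ↑↓-extensive (S ↓[ ⟦ x ⟧ ]) , downClosed x)
    , (λ a → ↓↑-extensive (S ↑[ ⟦ a ⟧ ]) , respects⇒upClosed S respects a)

  infixr 5 _⊙_
  _⊙_ : Rel A X → Rel A X → Rel A X
  (S ⊙ T) a x = (S ↓[ I ↑[ T ↓[ (⟦ x ⟧ ↓) ↑ ] ] ]) a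

  -- (S ⊙ T)↓[x] is S↓[Z] for a set Z, hence closed when S is down-closed.
  ⊙-pointwiseClosed : (S T : Rel A X) → DownClosed S →
                      ∀ x → ClosedA ((S ⊙ T) ↓[ ⟦ x ⟧ ])
  ⊙-pointwiseClosed S T closedS x a aZ _ refl =
    closedS (I ↑[ T ↓[ (⟦ x ⟧ ↓) ↑ ] ]) a
      (↑↓-monotone (λ b bSTx → bSTx x refl) a aZ)

  -- With W = S↑[a] and a ∈ (S ⊙ T)↓[Y], every y ∈ Y gives
  -- I↑[T↓[y↓↑]] ⊆ W, so W↓ ⊆ T↓[y↓↑] ⊆ T↓[y] by closedness of T↓[y↓↑].
  -- Thus W↓ ⊆ T↓[Y] ⊆ T↓[Y↓↑] ⊆ T↓[x↓↑] for x ∈ Y↓↑, and dually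
  -- I↑[T↓[x↓↑]] ⊆ W↓↑ ⊆ W, i.e. a ∈ (S ⊙ T)↓[x].
  ⊙-respects : (S T : Rel A X) → Compatible S → Compatible T →
               RespectsClosure (S ⊙ T)
  ⊙-respects S T compS compT Y a aY x xY = ⊆↑[]⇒↓[] S Zx⊆W
    where
    W : Subset X
    W = S ↑[ ⟦ a ⟧ ]

    W↓⊆T↓[y] : ∀ y → Y y → W ↓ ⊆ T ↓[ ⟦ y ⟧ ]
    W↓⊆T↓[y] y Yy b bW =
      ↓[]-antitone T (↓↑-extensive ⟦ y ⟧) b
        (compatible⇒downClosed T compT ((⟦ y ⟧ ↓) ↑) b
          (↓[]-antitone I (↓[]⇒⊆↑[] S (aY y Yy)) b bW))

    W↓⊆T↓[x↓↑] : W ↓ ⊆ T ↓[ (⟦ x ⟧ ↓) ↑ ]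
    W↓⊆T↓[x↓↑] b bW =
      ↓[]-antitone T (↓↑-member xY) b
        (compatible⇒respects T compT Y b (λ y Yy → W↓⊆T↓[y] y Yy b bW y refl))

    Zx⊆W : I ↑[ T ↓[ (⟦ x ⟧ ↓) ↑ ] ] ⊆ W
    Zx⊆W z zZ = proj₂ (proj₂ compS a) z (↑-antitone W↓⊆T↓[x↓↑] z zZ)

  ⊙-compatible : (S T : Rel A X) → Compatible S → Compatible T →
                 Compatible (S ⊙ T)
  ⊙-compatible S T compS compT =
    compatible-intro (S ⊙ T)
      (⊙-pointwiseClosed S T (compatible⇒downClosed S compS))
      (⊙-respects S T compS compT)

  -- R_{i t} = R_i ⊙ R_t definitionally, so compatibility propagates along
  -- the sequence, for any type of agents.
  Rseq-compatible : ∀ {a} {Ag : Set a} (R : Ag → Rel A X) →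
                    (∀ i → Compatible (R i)) →
                    ∀ i t → Compatible (Rseq R i t)
  Rseq-compatible R compR i []      = compR i
  Rseq-compatible R compR i (j ∷ t) =
    ⊙-compatible (R i) (Rseq R j t) (compR i) (Rseq-compatible R compR j t)

corollaryA8 : {ℓ : Level} {A X : Set ℓ} (I : Rel A X) (n : ℕ)
              (R : Fin n → Rel A X) →
              (∀ i → Galois.Compatible I (R i)) →
              (s : List⁺ (Fin n)) → Galois.Compatible I (Galois.Rₛ I R s)
corollaryA8 I n R compR (i ∷ t) = FormalContext.Rseq-compatible I R compR i t
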